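{- Let $c\in\mathsf{ACirc}[n,m]$ with initial state $c_0$. Then for every integer $t<0$ there is a transition $t\vdash c_0\to t+1\vdash c_0$ with left label $0\in k^n$ and right label $0\in k^m$.
   Context: Fix a field $k$. Circuits and sorts $(n,m)$: generators copier $\Delta:(1,2)$, discard $!:(1,0)$, adder $\mu:(2,1)$, zero $\mathsf 0:(0,1)$, one $\mathsf 1:(0,1)$, register $\mathsf x:(1,1)$, amplifier $\mathsf s_r:(1,1)$ ($r\in k$), mirror images $\Delta^{op}:(2,1)$, $!^{op}:(0,1)$, $\mu^{op}:(1,2)$, $\mathsf 0^{op}:(1,0)$, $\mathsf 1^{op}:(1,0)$, $\mathsf x^{op}:(1,1)$, $\mathsf s_r^{op}:(1,1)$, and $\mathrm{id}_0:(0,0)$, $\mathrm{id}_1:(1,1)$, $\mathrm{sw}:(2,2)$; closed under $c;d$ ($(n,z),(z,m)\mapsto(n,m)$) and $c\oplus d$ ($(n,m),(r,z)\mapsto(n+r,m+z)$). $\mathsf{ACirc}[n,m]$: circuits of sort $(n,m)$ (modulo symmetric monoidal laws). Operational semantics: a state stores a value of $k$ in each occurrence of $\mathsf x$ and $\mathsf x^{op}$; the initial state $c_0$ stores $0$ everywhere. Transitions $t\vdash c\to t+1\vdash c'$ ($t\in\mathbb Z$) carry labels "left / right" ($\bullet$ the empty vector) and are generated by (for all $a,b\in k$): $\Delta$: $a$ / $(a,a)$; $!$: $a$ / $\bullet$; $\mu$: $(a,b)$ / $a+b$; $\mathsf 0$: $\bullet$ / $0$; $\mathsf s_r$: $b$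 / $rb$; $\mathsf x$ storing $b$: $a$ / $b$, new state stores $a$; $\mathsf 1$: $\bullet$ / $1$ if $t=0$, $\bullet$ / $0$ if $t\ne0$; $\Delta^{op}$: $(a,a)$ / $a$; $!^{op}$: $\bullet$ / $a$; $\mu^{op}$: $a+b$ / $(a,b)$; $\mathsf 0^{op}$: $0$ / $\bullet$; $\mathsf s_r^{op}$: $rb$ / $b$; $\mathsf x^{op}$ storing $b$: $b$ / $a$, new state stores $a$; $\mathsf 1^{op}$: $1$ / $\bullet$ if $t=0$, $0$ / $\bullet$ otherwise; $\mathrm{id}_1$: $a$ / $a$; $\mathrm{sw}$: $(a,b)$ / $(b,a)$; $\mathrm{id}_0$: $\bullet$ / $\bullet$. If at time $t$, $c$ moves to $c'$ with $u$ / $v$ and $d$ to $d'$ with $v$ / $w$, then $c;d$ moves to $c';d'$ with $u$ / $w$; if $c$ moves with $u_1$ / $v_1$ and $d$ with $u_2$ / $v_2$, then $c\oplus d$ moves to $c'\oplus d'$ with $(u_1,u_2)$ / $(v_1,v_2)$. -}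

module Defs where

open import Level using (0ℓ)
open import Data.Nat using (ℕ; zero; suc) renaming (_+_ to _+ℕ_)
open import Data.Integer using (ℤ; 0ℤ)
open import Data.Vec using (Vec; []; _∷_; _++_)
open import Data.Product using (_×_; _,_; ∃)
open import Data.Unit using (⊤; tt)
open import Relation.Nullary using (¬_)
open import Relation.Binary.PropositionalEquality using (_≡_)
open import Algebra.Structures using (IsCommutativeRing)

record Field : Set₁ where
  infixl 7 _*_
  infixl 6 _+_
  field
    Carrier           : Set
    _+_ _*_           : Carrier → Carrier → Carrier
    -_                : Carrier → Carrier
    0# 1#             : Carrier
    isCommutativeRing : IsCommutativeRing _≡_ _+_ _*_ -_ 0# 1#
    0≢1               : ¬ (0# ≡ 1#)
    inverse           : ∀ x → ¬ (x ≡ 0#) → ∃ λ y → x * y ≡ 1#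

module _ (F : Field) where
  open Field F

  data Circ : ℕ → ℕ → Set where
    copy    : Circ 1 2
    disc    : Circ 1 0
    add     : Circ 2 1
    zer     : Circ 0 1
    one     : Circ 0 1
    reg     : Circ 1 1
    amp     : Carrier → Circ 1 1
    copyᵒᵖ  : Circ 2 1
    discᵒᵖ  : Circ 0 1
    addᵒᵖ   : Circ 1 2
    zerᵒᵖ   : Circ 1 0
    oneᵒᵖ   : Circ 1 0
    regᵒᵖ   : Circ 1 1
    ampᵒᵖ   : Carrier → Circ 1 1
    id₀     : Circ 0 0
    id₁     : Circ 1 1
    sw      : Circ 2 2
    _⨾_     : ∀ {n z m} → Circ n z → Circ z m → Circ n m
    _⊕_     : ∀ {n m r z} → Circ n m → Circ r z → Circ (n +ℕ r) (m +ℕ z)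

  State : ∀ {n m} → Circ n m → Set
  State reg       = Carrier
  State regᵒᵖ     = Carrier
  State (c ⨾ d)   = State c × State d
  State (c ⊕ d)   = State c × State d
  State _         = ⊤

  init : ∀ {n m} (c : Circ n m) → State c
  init copy     = tt
  init disc     = tt
  init add      = tt
  init zer      = tt
  init one      = tt
  init reg      = 0#
  init (amp r)  = tt
  init copyᵒᵖ   = tt
  init discᵒᵖ   = tt
  init addᵒᵖ    = tt
  init zerᵒᵖ    = tt
  init oneᵒᵖ    = tt
  init regᵒᵖ    = 0#
  init (ampᵒᵖ r) = tt
  init id₀      = tt
  init id₁      = tt
  init sw       = tt
  init (c ⨾ d)  = init c , init d
  init (c ⊕ d)  = init c , init d

  -- Step c t s s' u v :  transition  t ⊢ (c,s) → t+1 ⊢ (c,s')  with label u / v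
  data Step : ∀ {n m} (c : Circ n m) → ℤ → State c → State c
              → Vec Carrier n → Vec Carrier m → Set where
    copy-st   : ∀ {t} a → Step copy t tt tt (a ∷ []) (a ∷ a ∷ [])
    disc-st   : ∀ {t} a → Step disc t tt tt (a ∷ []) []
    add-st    : ∀ {t} a b → Step add t tt tt (a ∷ b ∷ []) (a + b ∷ [])
    zer-st    : ∀ {t} → Step zer t tt tt [] (0# ∷ [])
    amp-st    : ∀ {t} r b → Step (amp r) t tt tt (b ∷ []) (r * b ∷ [])
    reg-st    : ∀ {t} a b → Step reg t b a (a ∷ []) (b ∷ [])
    one-st₀   : ∀ {t} → t ≡ 0ℤ → Step one t tt tt [] (1# ∷ [])
    one-st    : ∀ {t} → ¬ (t ≡ 0ℤ) → Step one t tt tt [] (0# ∷ [])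
    copyᵒᵖ-st : ∀ {t} a → Step copyᵒᵖ t tt tt (a ∷ a ∷ []) (a ∷ [])
    discᵒᵖ-st : ∀ {t} a → Step discᵒᵖ t tt tt [] (a ∷ [])
    addᵒᵖ-st  : ∀ {t} a b → Step addᵒᵖ t tt tt (a + b ∷ []) (a ∷ b ∷ [])
    zerᵒᵖ-st  : ∀ {t} → Step zerᵒᵖ t tt tt (0# ∷ []) []
    ampᵒᵖ-st  : ∀ {t} r b → Step (ampᵒᵖ r) t tt tt (r * b ∷ []) (b ∷ [])
    regᵒᵖ-st  : ∀ {t} a b → Step regᵒᵖ t b a (b ∷ []) (a ∷ [])
    oneᵒᵖ-st₀ : ∀ {t} → t ≡ 0ℤ → Step oneᵒᵖ t tt tt (1# ∷ []) []
    oneᵒᵖ-st  : ∀ {t} → ¬ (t ≡ 0ℤ) → Step oneᵒᵖ t tt tt (0# ∷ []) []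
    id₁-st    : ∀ {t} a → Step id₁ t tt tt (a ∷ []) (a ∷ [])
    sw-st     : ∀ {t} a b → Step sw t tt tt (a ∷ b ∷ []) (b ∷ a ∷ [])
    id₀-st    : ∀ {t} → Step id₀ t tt tt [] []
    seq-st    : ∀ {t n z m} {c : Circ n z} {d : Circ z m} {s s' r r' u v w}
                → Step c t s s' u v → Step d t r r' v w
                → Step (c ⨾ d) t (s , r) (s' , r') u w
    par-st    : ∀ {t n m p q} {c : Circ n m} {d : Circ p q} {s s' r r' u₁ v₁ u₂ v₂}
                → Step c t s s' u₁ v₁ → Step d t r r' u₂ v₂
                → Step (c ⊕ d) t (s , r) (s' , r') (u₁ ++ u₂) (v₁ ++ v₂)

module Submission where

-- For a generator the
-- transition rule is instantiated at 0; the only arithmetic needed is that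
-- 0 + 0 = 0 (adder and its mirror) and r · 0 = 0 (amplifier and its
-- mirror), while the constants 1 and 1ᵒᵖ emit 0 precisely because t ≢ 0.
-- Registers store 0 and receive 0, so their state stays 0.  Sequential
-- composition glues the two idle steps along the zero vector in the middle;
-- parallel composition needs that concatenating zero vectors gives a zero
-- vector.  The theorem is the special case t < 0.

open import Defs
open import Data.Nat using (ℕ; zero; suc) renaming (_+_ to _+ℕ_)
open import Data.Integer using (ℤ; 0ℤ; _<_)
open import Data.Integer.Properties using (<⇒≢)
open import Data.Vec using (Vec; replicate; _++_; []; _∷_)
open import Relation.Binary.PropositionalEquality
  using (_≡_; _≢_; refl; cong; subst; subst₂)
open import Algebra.Structures using (IsCommutativeRing)

replicate-++ : ∀ {A : Set} (a : A) n p →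
               replicate n a ++ replicate p a ≡ replicate (n +ℕ p) a
replicate-++ a zero    p = refl
replicate-++ a (suc n) p = cong (a ∷_) (replicate-++ a n p)

module Idle (F : Field) where
  open Field F
  open IsCommutativeRing isCommutativeRing using (+-identityˡ; zeroʳ)

  0̅ : ∀ n → Vec Carrier n
  0̅ n = replicate n 0#

  idle : ∀ {n m} (c : Circ F n m) {t : ℤ} → t ≢ 0ℤ
       → Step F c t (init F c) (init F c) (0̅ n) (0̅ m)
  idle copy      t≢0 = copy-st 0#
  idle disc      t≢0 = disc-st 0#
  idle add       t≢0 = subst (λ x → Step F add _ _ _ _ (x ∷ [])) (+-identityˡ 0#) (add-st 0# 0#)
  idle zer       t≢0 = zer-st
  idle one       t≢0 = one-st t≢0
  idle reg       t≢0 = reg-st 0# 0#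
  idle (amp r)   t≢0 = subst (λ x → Step F (amp r) _ _ _ _ (x ∷ [])) (zeroʳ r) (amp-st r 0#)
  idle copyᵒᵖ    t≢0 = copyᵒᵖ-st 0#
  idle discᵒᵖ    t≢0 = discᵒᵖ-st 0#
  idle addᵒᵖ     t≢0 = subst (λ x → Step F addᵒᵖ _ _ _ (x ∷ []) _) (+-identityˡ 0#) (addᵒᵖ-st 0# 0#)
  idle zerᵒᵖ     t≢0 = zerᵒᵖ-st
  idle oneᵒᵖ     t≢0 = oneᵒᵖ-st t≢0
  idle regᵒᵖ     t≢0 = regᵒᵖ-st 0# 0#
  idle (ampᵒᵖ r) t≢0 = subst (λ x → Step F (ampᵒᵖ r) _ _ _ (x ∷ []) _) (zeroʳ r) (ampᵒᵖ-st r 0#)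
  idle id₀       t≢0 = id₀-st
  idle id₁       t≢0 = id₁-st 0#
  idle sw        t≢0 = sw-st 0# 0#
  idle (c ⨾ d)   t≢0 = seq-st (idle c t≢0) (idle d t≢0)
  idle (_⊕_ {n} {m} {p} {q} c d) t≢0 =
    subst₂ (Step F (c ⊕ d) _ _ _) (replicate-++ 0# n p) (replicate-++ 0# m q)
      (par-st (idle c t≢0) (idle d t≢0))

lemma2 : (F : Field) {n m : ℕ} (c : Circ F n m) (t : ℤ) → t < 0ℤ
         → Step F c t (init F c) (init F c) (replicate n (Field.0# F)) (replicate m (Field.0# F))
lemma2 F c t t<0 = Idle.idle F c (<⇒≢ t<0)
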